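{- (i) Let $z\in\mathbb{Q}$ with $0<z<1$, written $z=\frac{a}{b}$ with $a,b\in\mathbb{N}$. Let $m\ge 2$ and $v=b^mf_0f_1\cdots f_m$ with $f_0,\dots,f_m\in\mathbb{N}$. Then there exists a non-disjoint $(v,m,vz,vz^2)$-PSEDF in $\mathbb{Z}_v$. (ii) Let $f\in\mathbb{N}$, let $b,m$ be integers with $b,m\ge 2$, let $v=b^mf$, and let $a\in\mathbb{N}$ with $1\le a<b$. Then there exists a non-disjoint $(b^mf,\,m,\,ab^{m-1}f,\,a^2b^{m-2}f)$-PSEDF in $\mathbb{Z}_{b^mf}$.
   Context: For subsets $A,B$ of an additively written group $G$, $\Delta(A,B)$ denotes the multiset $\{a-b:a\in A,b\in B\}$ (one entry per pair). For $\lambda\in\mathbb{N}$, $\lambda G$ is the multiset containing every element of $G$ exactly $\lambda$ times. For a group $G$ of order $v$ and $m>1$, a family of $k$-subsets $\{A_1,\dots,A_m\}$ of $G$ is a non-disjoint $(v,m,k,\lambda)$-PSEDF if $\Delta(A_i,A_j)=\lambda G$ for all $1\le i\ne j\le m$. -}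

module Defs where

open import Data.Nat using (ℕ; zero; suc; _+_; _*_; _∸_; _^_; _≤_; _<_)
open import Data.Nat.DivMod using (_mod_)
open import Data.Fin using (Fin; toℕ)
open import Data.Fin.Subset using (Subset; ∣_∣)
open import Data.Fin.Subset.Properties using (_∈?_)
open import Data.Fin.Properties using (_≟_)
open import Data.List using (List; length; filter; cartesianProduct)
open import Data.List.Base using (allFin)
open import Data.Product using (_×_; _,_; proj₁; proj₂; Σ)
open import Relation.Binary.PropositionalEquality using (_≡_)

-- Subtraction in the cyclic group Z_v, with carrier Fin v (elements 0..v-1).
-- For v = 0 the carrier Fin 0 is empty.
_⊖_ : ∀ {v} → Fin v → Fin v → Fin v
_⊖_ {suc n} x y = (toℕ x + (suc n ∸ toℕ y)) mod (suc n)

elems : ∀ {v} → Subset v → List (Fin v)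
elems {v} A = filter (_∈? A) (allFin v)

-- multiplicity of g in the multiset Δ(A,B) = {a - b : a ∈ A, b ∈ B}
ΔCount : ∀ {v} → Subset v → Subset v → Fin v → ℕ
ΔCount A B g =
  length (filter (λ p → (proj₁ p ⊖ proj₂ p) ≟ g) (cartesianProduct (elems A) (elems B)))

ΔIs : ∀ {v} → Subset v → Subset v → ℕ → Set
ΔIs {v} A B λ' = (g : Fin v) → ΔCount A B g ≡ λ'

-- a non-disjoint (v,m,k,λ)-PSEDF in Z_v: a family A_1..A_m of k-subsets of Z_v
-- with Δ(A_i,A_j) = λ Z_v for all i ≠ j  (m > 1 is required by the definition)
IsPSEDF : (v m k λ' : ℕ) → (Fin m → Subset v) → Set
IsPSEDF v m k λ' A =
  (1 < m) × ((i : Fin m) → ∣ A i ∣ ≡ k) ×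
  ((i j : Fin m) → (i ≡ j → Data.Empty.⊥) → ΔIs (A i) (A j) λ')
  where import Data.Empty

PSEDFExists : (v m k λ' : ℕ) → Set
PSEDFExists v m k λ' = Σ (Fin m → Subset v) (IsPSEDF v m k λ')

prodFin : ∀ n → (Fin n → ℕ) → ℕ
prodFin zero f = 1
prodFin (suc n) f = f Fin.zero * prodFin n (λ i → f (Fin.suc i))
  where import Data.Fin as Fin

{-# OPTIONS --safe #-}
-- Identify Z_v, v = b^m F, with {0, …, v-1} and let A_i (i < m) be the residues whose i-th
-- base-b digit is below a, so that |A_i| = a b^(m-1) F. For j < i, the number of x ∈ A_i with
-- x - g ∈ A_j is a correlation sum over Z_v. Writing x = r + q b^(j+1) with r < b^(j+1), the
-- i-th digit of x is a digit of q, while membership of x - g in A_j only depends on r - g modulo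
-- b^(j+1), whose digit counts are translation invariant; so the sum factorises as
-- (a b^(m-j-2) F) (a b^j) = a² b^(m-2) F for every g. The case i < j follows by translating x by g.
-- Part (i) is the case f = f_0 ⋯ f_m, since k and λ are forced to be a b^(m-1) f and a² b^(m-2) f.
module Submission where

open import Defs
open import Data.Nat using (ℕ; zero; suc; _+_; _*_; _∸_; _^_; _≤_; _<_; _<ᵇ_; z≤n; s≤s; z<s; s<s; NonZero; >-nonZero)
open import Data.Nat.Properties using (+-assoc; +-comm; +-identityʳ; +-suc; +-cancelʳ-≡; +-commutativeSemigroup; *-assoc; *-comm; *-identityˡ; *-zeroʳ; *-distribˡ-+; *-mono-≤; *-cancelʳ-≡; ^-distribˡ-+-*; m^n≢0; m*n≢0; <⇒≤; ≤-<-trans; <-cmp; m∸n≤m; m∸[m∸n]≡n; m+[n∸m]≡n; m≤n⇒∃[o]m+o≡n; suc-pred)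
open import Data.Nat.DivMod
open import Data.Nat.Divisibility using (divides)
open import Data.Nat.ListAction using (sum)
open import Data.Nat.ListAction.Properties using (sum-++)
open import Data.Nat.Tactic.RingSolver using (solve-∀)
open import Algebra.Properties.CommutativeSemigroup +-commutativeSemigroup using (x∙yz≈y∙xz; x∙yz≈xz∙y; xy∙z≈xz∙y)
open import Data.Bool using (Bool; true; false)
open import Data.Fin using (Fin; toℕ) renaming (zero to fzero; suc to fsuc)
open import Data.Fin.Properties using (_≟_; toℕ-injective; toℕ-fromℕ<; toℕ<n)
open import Data.Fin.Subset using (Subset; ∣_∣)
open import Data.Fin.Subset.Properties using (_∈?_)
open import Data.List using ([]; _∷_; _++_; map; filter; length; cartesianProduct; tabulate; allFin)
open import Data.List.Properties using (map-++; map-∘; map-cong; map-tabulate; tabulate-cong)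
import Data.Vec as Vec
open import Data.Product using (_×_; _,_; proj₁; proj₂)
open import Function using (_∘_; id; _⇔_; mk⇔)
open import Relation.Nullary using (does; contradiction)
open import Relation.Nullary.Decidable using (does-⇔)
open import Relation.Unary using (Decidable)
open import Relation.Binary.Definitions using (tri<; tri≈; tri>)
open import Relation.Binary.PropositionalEquality using (_≡_; _≢_; refl; sym; trans; cong; cong₂; subst; subst₂; module ≡-Reasoning)

[m%n+k]%n≡[m+k]%n : ∀ m k n .{{_ : NonZero n}} → (m % n + k) % n ≡ (m + k) % n
[m%n+k]%n≡[m+k]%n m k n = begin
  (m % n + k) % n          ≡⟨ %-distribˡ-+ (m % n) k n ⟩
  (m % n % n + k % n) % n  ≡⟨ cong (λ y → (y + k % n) % n) (m%n%n≡m%n m n) ⟩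
  (m % n + k % n) % n      ≡⟨ %-distribˡ-+ m k n ⟨
  (m + k) % n              ∎
  where open ≡-Reasoning

[[m+k]%n+[n∸k]]%n≡m : ∀ {m k n} .{{_ : NonZero n}} → k ≤ n → m < n → ((m + k) % n + (n ∸ k)) % n ≡ m
[[m+k]%n+[n∸k]]%n≡m {m} {k} {n} k≤n m<n = begin
  ((m + k) % n + (n ∸ k)) % n  ≡⟨ [m%n+k]%n≡[m+k]%n (m + k) (n ∸ k) n ⟩
  (m + k + (n ∸ k)) % n        ≡⟨ %-congˡ (trans (+-assoc m k (n ∸ k)) (cong (m +_) (m+[n∸m]≡n k≤n))) ⟩
  (m + n) % n                  ≡⟨ [m+n]%n≡m%n m n ⟩
  m % n                        ≡⟨ m<n⇒m%n≡m m<n ⟩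
  m                            ∎
  where open ≡-Reasoning

[m+kn]/n≡k : ∀ {m} k {n} .{{_ : NonZero n}} → m < n → (m + k * n) / n ≡ k
[m+kn]/n≡k {m} k {n} m<n = trans (+-distrib-/-∣ʳ m (divides k refl)) (cong₂ _+_ (m<n⇒m/n≡0 m<n) (m*n/n≡m k n))

𝟙 : Bool → ℕ
𝟙 true  = 1
𝟙 false = 0

∑< : ℕ → (ℕ → ℕ) → ℕ
∑< zero    f = 0
∑< (suc n) f = f 0 + ∑< n (f ∘ suc)

syntax ∑< n (λ x → e) = ∑[ x < n ] e

∑-cong : ∀ n {f g : ℕ → ℕ} → (∀ {x} → x < n → f x ≡ g x) → ∑< n f ≡ ∑< n g
∑-cong zero    f≡g = refl
∑-cong (suc n) f≡g = cong₂ _+_ (f≡g z<s) (∑-cong n (f≡g ∘ s<s))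

∑-const : ∀ n c → ∑[ _ < n ] c ≡ n * c
∑-const zero    c = refl
∑-const (suc n) c = cong (c +_) (∑-const n c)

∑-<ᵇ : ∀ {a n} → a ≤ n → ∑[ d < n ] 𝟙 (d <ᵇ a) ≡ a
∑-<ᵇ {n = n} z≤n  = trans (∑-const n 0) (*-zeroʳ n)
∑-<ᵇ (s≤s a≤n) = cong suc (∑-<ᵇ a≤n)

∑-*ˡ : ∀ n c f → ∑[ x < n ] (c * f x) ≡ c * ∑< n f
∑-*ˡ zero    c f = sym (*-zeroʳ c)
∑-*ˡ (suc n) c f = trans (cong (c * f 0 +_) (∑-*ˡ n c (f ∘ suc))) (sym (*-distribˡ-+ c (f 0) _))

∑-*ʳ : ∀ n c f → ∑[ x < n ] (f x * c) ≡ ∑< n f * c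
∑-*ʳ n c f = begin
  ∑[ x < n ] (f x * c)  ≡⟨ ∑-cong n (λ {x} _ → *-comm (f x) c) ⟩
  ∑[ x < n ] (c * f x)  ≡⟨ ∑-*ˡ n c f ⟩
  c * ∑< n f            ≡⟨ *-comm c _ ⟩
  ∑< n f * c            ∎
  where open ≡-Reasoning

∑-+ : ∀ m n f → ∑< (m + n) f ≡ ∑< m f + ∑[ x < n ] f (m + x)
∑-+ zero    n f = refl
∑-+ (suc m) n f = trans (cong (f 0 +_) (∑-+ m n (f ∘ suc))) (sym (+-assoc (f 0) _ _))

∑-suc : ∀ n f → ∑< (suc n) f ≡ ∑< n f + f n
∑-suc zero    f = +-comm (f 0) 0
∑-suc (suc n) f = trans (cong (f 0 +_) (∑-suc n (f ∘ suc))) (sym (+-assoc (f 0) _ _))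

∑-blocks : ∀ N P f → ∑< (N * P) f ≡ ∑[ q < N ] ∑[ r < P ] f (r + q * P)
∑-blocks zero    P f = refl
∑-blocks (suc N) P f = begin
  ∑< (P + N * P) f
    ≡⟨ ∑-+ P (N * P) f ⟩
  ∑< P f + ∑[ x < N * P ] f (P + x)
    ≡⟨ cong₂ _+_ (∑-cong P (λ {r} _ → cong f (sym (+-identityʳ r)))) (∑-blocks N P (λ x → f (P + x))) ⟩
  ∑[ r < P ] f (r + 0) + ∑[ q < N ] ∑[ r < P ] f (P + (r + q * P))
    ≡⟨ cong (∑[ r < P ] f (r + 0) +_) (∑-cong N (λ {q} _ → ∑-cong P (λ {r} _ → cong f (x∙yz≈y∙xz P r (q * P))))) ⟩
  ∑[ r < P ] f (r + 0) + ∑[ q < N ] ∑[ r < P ] f (r + (P + q * P))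
    ∎
  where open ≡-Reasoning

-- Periodic functions and correlation sums

Periodic : {A : Set} → ℕ → (ℕ → A) → Set
Periodic P g = ∀ x → g (x + P) ≡ g x

module _ {A : Set} {P : ℕ} {g : ℕ → A} (g-periodic : Periodic P g) where

  periodic-+* : ∀ x q → g (x + q * P) ≡ g x
  periodic-+* x zero    = cong g (+-identityʳ x)
  periodic-+* x (suc q) = begin
    g (x + (P + q * P))  ≡⟨ cong g (x∙yz≈xz∙y x P (q * P)) ⟩
    g (x + q * P + P)    ≡⟨ g-periodic (x + q * P) ⟩
    g (x + q * P)        ≡⟨ periodic-+* x q ⟩
    g x                  ∎
    where open ≡-Reasoning

  periodic-% : ∀ {v N} .{{_ : NonZero v}} → v ≡ N * P → ∀ x → g (x % v) ≡ g x
  periodic-% {v} {N} refl x = begin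
    g (x % v)                      ≡⟨ periodic-+* (x % v) (x / v * N) ⟨
    g (x % v + x / v * N * P)      ≡⟨ cong (λ y → g (x % v + y)) (*-assoc (x / v) N P) ⟩
    g (x % v + x / v * v)          ≡⟨ cong g (m≡m%n+[m/n]*n x v) ⟨
    g x                            ∎
    where open ≡-Reasoning

  periodic-shift : ∀ h → Periodic P (λ x → g (x + h))
  periodic-shift h x = trans (cong g (xy∙z≈xz∙y x P h)) (g-periodic (x + h))

module _ {P : ℕ} {g : ℕ → ℕ} (g-periodic : Periodic P g) where

  ∑-rotate-suc : ∑< P (g ∘ suc) ≡ ∑< P g
  ∑-rotate-suc = +-cancelʳ-≡ (g 0) _ _ (begin
    ∑< P (g ∘ suc) + g 0  ≡⟨ +-comm _ (g 0) ⟩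
    ∑< (suc P) g          ≡⟨ ∑-suc P g ⟩
    ∑< P g + g P          ≡⟨ cong (∑< P g +_) (g-periodic 0) ⟩
    ∑< P g + g 0          ∎)
    where open ≡-Reasoning

  ∑-periodic : ∀ N → ∑< (N * P) g ≡ N * ∑< P g
  ∑-periodic N = begin
    ∑< (N * P) g                            ≡⟨ ∑-blocks N P g ⟩
    ∑[ q < N ] ∑[ r < P ] g (r + q * P)     ≡⟨ ∑-cong N (λ {q} _ → ∑-cong P (λ {r} _ → periodic-+* g-periodic r q)) ⟩
    ∑[ q < N ] ∑< P g                       ≡⟨ ∑-const N _ ⟩
    N * ∑< P g                              ∎
    where open ≡-Reasoning

∑-rotate : ∀ {P} {g : ℕ → ℕ} → Periodic P g → ∀ h → ∑[ x < P ] g (x + h) ≡ ∑< P g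
∑-rotate {P} {g} g-periodic zero    = ∑-cong P (λ {x} _ → cong g (+-identityʳ x))
∑-rotate {P} {g} g-periodic (suc h) = begin
  ∑[ x < P ] g (x + suc h)    ≡⟨ ∑-cong P (λ {x} _ → cong g (+-suc x h)) ⟩
  ∑[ x < P ] g (suc x + h)    ≡⟨ ∑-rotate-suc (periodic-shift g-periodic h) ⟩
  ∑[ x < P ] g (x + h)        ≡⟨ ∑-rotate g-periodic h ⟩
  ∑< P g                      ∎
  where open ≡-Reasoning

∑-rotate-% : ∀ v .{{_ : NonZero v}} (f : ℕ → ℕ) h → ∑[ x < v ] f ((x + h) % v) ≡ ∑< v f
∑-rotate-% v f h = begin
  ∑[ x < v ] f ((x + h) % v)  ≡⟨ ∑-rotate (λ x → cong f ([m+n]%n≡m%n x v)) h ⟩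
  ∑[ x < v ] f (x % v)        ≡⟨ ∑-cong v (cong f ∘ m<n⇒m%n≡m) ⟩
  ∑< v f                      ∎
  where open ≡-Reasoning

correlation : (v : ℕ) .{{_ : NonZero v}} → (ℕ → ℕ) → (ℕ → ℕ) → ℕ → ℕ
correlation v f g h = ∑[ x < v ] (f x * g ((x + h) % v))

correlation-comm : ∀ v .{{_ : NonZero v}} f g {k} → k ≤ v → correlation v f g (v ∸ k) ≡ correlation v g f k
correlation-comm v f g {k} k≤v = begin
  ∑[ x < v ] (f x * g ((x + (v ∸ k)) % v))
    ≡⟨ ∑-rotate-% v (λ x → f x * g ((x + (v ∸ k)) % v)) k ⟨
  ∑[ x < v ] (f ((x + k) % v) * g (((x + k) % v + (v ∸ k)) % v))
    ≡⟨ ∑-cong v (λ {x} x<v → trans (*-comm (f ((x + k) % v)) _) (cong (λ y → g y * f ((x + k) % v)) ([[m+k]%n+[n∸k]]%n≡m k≤v x<v))) ⟩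
  ∑[ x < v ] (g x * f ((x + k) % v))
    ∎
  where open ≡-Reasoning

correlation-factorise : ∀ {v N P} .{{_ : NonZero v}} → v ≡ N * P → ∀ {f g F : ℕ → ℕ} →
  (∀ q {r} → r < P → f (r + q * P) ≡ F q) → Periodic P g → ∀ h →
  correlation v f g h ≡ ∑< N F * ∑< P g
correlation-factorise {v} {N} {P} v≡NP {f} {g} {F} f≡F g-periodic h = begin
  ∑[ x < v ] (f x * g ((x + h) % v))
    ≡⟨ cong (λ n → ∑[ x < n ] (f x * g ((x + h) % v))) v≡NP ⟩
  ∑[ x < N * P ] (f x * g ((x + h) % v))
    ≡⟨ ∑-blocks N P _ ⟩
  ∑[ q < N ] ∑[ r < P ] (f (r + q * P) * g ((r + q * P + h) % v))
    ≡⟨ ∑-cong N (λ {q} _ → ∑-cong P (λ r<P → cong₂ _*_ (f≡F q r<P) (g-shifted q _))) ⟩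
  ∑[ q < N ] ∑[ r < P ] (F q * g (r + h))
    ≡⟨ ∑-cong N (λ {q} _ → trans (∑-*ˡ P (F q) _) (cong (F q *_) (∑-rotate g-periodic h))) ⟩
  ∑[ q < N ] (F q * ∑< P g)
    ≡⟨ ∑-*ʳ N _ F ⟩
  ∑< N F * ∑< P g
    ∎
  where
  open ≡-Reasoning
  g-shifted : ∀ q r → g ((r + q * P + h) % v) ≡ g (r + h)
  g-shifted q r = begin
    g ((r + q * P + h) % v)  ≡⟨ periodic-% {P = P} {g = g} g-periodic {N = N} v≡NP _ ⟩
    g (r + q * P + h)        ≡⟨ cong g (xy∙z≈xz∙y r (q * P) h) ⟩
    g (r + h + q * P)        ≡⟨ periodic-+* {g = g} g-periodic (r + h) q ⟩
    g (r + h)                ∎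

-- Counting differences in Z_v

module _ {A : Set} {P : A → Set} (P? : Decidable P) where

  length-filter≡sum : ∀ xs → length (filter P? xs) ≡ sum (map (𝟙 ∘ does ∘ P?) xs)
  length-filter≡sum []       = refl
  length-filter≡sum (x ∷ xs) with does (P? x)
  ... | true  = cong suc (length-filter≡sum xs)
  ... | false = length-filter≡sum xs

  sum-map-filter : ∀ (f : A → ℕ) xs → sum (map f (filter P? xs)) ≡ sum (map (λ x → 𝟙 (does (P? x)) * f x) xs)
  sum-map-filter f []       = refl
  sum-map-filter f (x ∷ xs) with does (P? x)
  ... | true  = cong₂ _+_ (sym (*-identityˡ (f x))) (sum-map-filter f xs)
  ... | false = sum-map-filter f xs

sum-map-++ : ∀ {A : Set} (f : A → ℕ) xs ys → sum (map f (xs ++ ys)) ≡ sum (map f xs) + sum (map f ys)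
sum-map-++ f xs ys = trans (cong sum (map-++ f xs ys)) (sum-++ (map f xs) (map f ys))

sum-map-cartesianProduct : ∀ {A B : Set} (h : A × B → ℕ) xs ys →
  sum (map h (cartesianProduct xs ys)) ≡ sum (map (λ x → sum (map (λ y → h (x , y)) ys)) xs)
sum-map-cartesianProduct h []       ys = refl
sum-map-cartesianProduct h (x ∷ xs) ys = trans (sum-map-++ h (map (x ,_) ys) _)
  (cong₂ _+_ (cong sum (sym (map-∘ ys))) (sum-map-cartesianProduct h xs ys))

sum-tabulate-toℕ : ∀ n {h : Fin n → ℕ} (F : ℕ → ℕ) → (∀ i → h i ≡ F (toℕ i)) → sum (tabulate h) ≡ ∑< n F
sum-tabulate-toℕ zero    F h≡F = refl
sum-tabulate-toℕ (suc n) F h≡F = cong₂ _+_ (h≡F fzero) (sum-tabulate-toℕ n (F ∘ suc) (h≡F ∘ fsuc))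

sum-tabulate-zero : ∀ n → sum (tabulate {n = n} (λ _ → 0)) ≡ 0
sum-tabulate-zero zero    = refl
sum-tabulate-zero (suc n) = sum-tabulate-zero n

sum-tabulate-δ : ∀ {n} (c : Fin n) (F : Fin n → ℕ) → sum (tabulate (λ y → 𝟙 (does (y ≟ c)) * F y)) ≡ F c
sum-tabulate-δ {suc n} fzero    F = trans (cong₂ _+_ (*-identityˡ (F fzero)) (sum-tabulate-zero n)) (+-identityʳ _)
sum-tabulate-δ {suc n} (fsuc c) F = sum-tabulate-δ c (F ∘ fsuc)

toℕ-⊖ : ∀ {n} (x y : Fin (suc n)) → toℕ (x ⊖ y) ≡ (toℕ x + (suc n ∸ toℕ y)) % suc n
toℕ-⊖ x y = toℕ-fromℕ< _

-- x ⊖ y ≡ g says that (g + y) % v ≡ x, which is symmetric in y and g.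
⊖-swap : ∀ {n} (x y g : Fin (suc n)) → x ⊖ y ≡ g → x ⊖ g ≡ y
⊖-swap {n} x y _ refl = toℕ-injective (begin
  toℕ (x ⊖ (x ⊖ y))           ≡⟨ toℕ-⊖ x (x ⊖ y) ⟩
  (X + (v ∸ G)) % v           ≡⟨ cong (λ z → (z + (v ∸ G)) % v) X≡[G+Y]%v ⟩
  ((G + Y) % v + (v ∸ G)) % v ≡⟨ cong (λ z → (z % v + (v ∸ G)) % v) (+-comm G Y) ⟩
  ((Y + G) % v + (v ∸ G)) % v ≡⟨ [[m+k]%n+[n∸k]]%n≡m (<⇒≤ (toℕ<n (x ⊖ y))) (toℕ<n y) ⟩
  Y                           ∎)
  where
  open ≡-Reasoning
  v = suc n
  X = toℕ x
  Y = toℕ y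
  G = toℕ (x ⊖ y)
  X≡[G+Y]%v : X ≡ (G + Y) % v
  X≡[G+Y]%v = sym (begin
    (G + Y) % v                             ≡⟨ cong (λ z → (z + Y) % v) (toℕ-⊖ x y) ⟩
    ((X + (v ∸ Y)) % v + Y) % v             ≡⟨ cong (λ z → ((X + (v ∸ Y)) % v + z) % v) (m∸[m∸n]≡n (<⇒≤ (toℕ<n y))) ⟨
    ((X + (v ∸ Y)) % v + (v ∸ (v ∸ Y))) % v ≡⟨ [[m+k]%n+[n∸k]]%n≡m (m∸n≤m v Y) (toℕ<n x) ⟩
    X                                       ∎)

⊖≡⇔≡⊖ : ∀ {n} (x y g : Fin (suc n)) → x ⊖ y ≡ g ⇔ y ≡ x ⊖ g
⊖≡⇔≡⊖ x y g = mk⇔ (sym ∘ ⊖-swap x y g) (λ y≡x⊖g → subst (λ y → x ⊖ y ≡ g) (sym y≡x⊖g) (⊖-swap x g (x ⊖ g) refl))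

ΔCount≡sum : ∀ {n} (A B : Subset (suc n)) (g : Fin (suc n)) →
  ΔCount A B g ≡ sum (tabulate (λ x → 𝟙 (does (x ∈? A)) * 𝟙 (does (x ⊖ g ∈? B))))
ΔCount≡sum {n} A B g = begin
  ΔCount A B g
    ≡⟨ length-filter≡sum Q? (cartesianProduct (elems A) (elems B)) ⟩
  sum (map (𝟙 ∘ does ∘ Q?) (cartesianProduct (elems A) (elems B)))
    ≡⟨ sum-map-cartesianProduct (𝟙 ∘ does ∘ Q?) (elems A) (elems B) ⟩
  sum (map (λ x → sum (map (δ x) (elems B))) (elems A))
    ≡⟨ sum-map-filter (_∈? A) (λ x → sum (map (δ x) (elems B))) (allFin _) ⟩
  sum (map (λ x → 𝟙 (does (x ∈? A)) * sum (map (δ x) (elems B))) (allFin _))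
    ≡⟨ cong sum (map-cong (λ x → cong (𝟙 (does (x ∈? A)) *_) (sum-δ x)) (allFin _)) ⟩
  sum (map (λ x → 𝟙 (does (x ∈? A)) * 𝟙 (does (x ⊖ g ∈? B))) (allFin _))
    ≡⟨ cong sum (map-tabulate id (λ x → 𝟙 (does (x ∈? A)) * 𝟙 (does (x ⊖ g ∈? B)))) ⟩
  sum (tabulate (λ x → 𝟙 (does (x ∈? A)) * 𝟙 (does (x ⊖ g ∈? B))))
    ∎
  where
  open ≡-Reasoning
  Q? : Decidable (λ (p : Fin (suc n) × Fin (suc n)) → proj₁ p ⊖ proj₂ p ≡ g)
  Q? p = (proj₁ p ⊖ proj₂ p) ≟ g
  δ : Fin (suc n) → Fin (suc n) → ℕ
  δ x y = 𝟙 (does (x ⊖ y ≟ g))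
  sum-δ : ∀ x → sum (map (δ x) (elems B)) ≡ 𝟙 (does (x ⊖ g ∈? B))
  sum-δ x = begin
    sum (map (δ x) (elems B))
      ≡⟨ sum-map-filter (_∈? B) (δ x) (allFin _) ⟩
    sum (map (λ y → 𝟙 (does (y ∈? B)) * δ x y) (allFin _))
      ≡⟨ cong sum (map-tabulate id (λ y → 𝟙 (does (y ∈? B)) * δ x y)) ⟩
    sum (tabulate (λ y → 𝟙 (does (y ∈? B)) * δ x y))
      ≡⟨ cong sum (tabulate-cong (λ y → trans (*-comm (𝟙 (does (y ∈? B))) (δ x y))
           (cong (λ b → 𝟙 b * 𝟙 (does (y ∈? B))) (does-⇔ (⊖≡⇔≡⊖ x y g) (x ⊖ y ≟ g) (y ≟ x ⊖ g))))) ⟩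
    sum (tabulate (λ y → 𝟙 (does (y ≟ x ⊖ g)) * 𝟙 (does (y ∈? B))))
      ≡⟨ sum-tabulate-δ (x ⊖ g) (λ y → 𝟙 (does (y ∈? B))) ⟩
    𝟙 (does (x ⊖ g ∈? B))
      ∎

residues : ∀ {n} → (ℕ → Bool) → Subset n
residues p = Vec.tabulate (p ∘ toℕ)

does-∈?-residues : ∀ {n} (p : ℕ → Bool) (x : Fin n) → does (x ∈? residues p) ≡ p (toℕ x)
does-∈?-residues p fzero with p 0
... | true  = refl
... | false = refl
does-∈?-residues p (fsuc x) = does-∈?-residues (p ∘ suc) x

∣residues∣ : ∀ n (p : ℕ → Bool) → ∣ residues {n} p ∣ ≡ ∑[ x < n ] 𝟙 (p x)
∣residues∣ zero    p = refl
∣residues∣ (suc n) p with p 0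
... | true  = cong suc (∣residues∣ n (p ∘ suc))
... | false = ∣residues∣ n (p ∘ suc)

ΔCount-residues : ∀ {n} (p q : ℕ → Bool) (g : Fin (suc n)) →
  ΔCount (residues p) (residues q) g ≡ correlation (suc n) (𝟙 ∘ p) (𝟙 ∘ q) (suc n ∸ toℕ g)
ΔCount-residues {n} p q g = trans (ΔCount≡sum (residues p) (residues q) g) (sum-tabulate-toℕ (suc n)
  (λ x → 𝟙 (p x) * 𝟙 (q ((x + (suc n ∸ toℕ g)) % suc n))) (λ x →
  cong₂ (λ b c → 𝟙 b * 𝟙 c) (does-∈?-residues p x) (trans (does-∈?-residues q (x ⊖ g)) (cong q (toℕ-⊖ x g)))))

-- Subsets of Z_v defined by base-b digits

module DigitSets (b : ℕ) .{{_ : NonZero b}} {a : ℕ} (a≤b : a ≤ b) where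

  digit : ℕ → ℕ → ℕ
  digit s x = x / b ^ s % b
    where instance _ = m^n≢0 b s

  digit<a : ℕ → ℕ → Bool
  digit<a s x = digit s x <ᵇ a

  digit-periodic : ∀ s → Periodic (b ^ suc s) (digit s)
  digit-periodic s x = trans (cong (_% b) x+b^[1+s]/b^s) ([m+n]%n≡m%n (x / b ^ s) b)
    where
    instance _ = m^n≢0 b s
    x+b^[1+s]/b^s : (x + b * b ^ s) / b ^ s ≡ x / b ^ s + b
    x+b^[1+s]/b^s = trans (+-distrib-/-∣ʳ x {d = b ^ s} (divides b refl)) (cong (x / b ^ s +_) (m*n/n≡m b (b ^ s)))

  digit-low : ∀ s {r d} → r < b ^ s → d < b → digit s (r + d * b ^ s) ≡ d
  digit-low s {d = d} r<b^s d<b = trans (cong (_% b) ([m+kn]/n≡k d r<b^s)) (m<n⇒m%n≡m d<b)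
    where instance _ = m^n≢0 b s

  digit-high : ∀ s u q {r} → r < b ^ suc s → digit (suc s + u) (r + q * b ^ suc s) ≡ digit u q
  digit-high s u q {r} r<P = cong (_% b) (begin
    x / b ^ (suc s + u)     ≡⟨ /-congʳ (^-distribˡ-+-* b (suc s) u) ⟩
    x / (P * b ^ u)         ≡⟨ m/n/o≡m/[n*o] x P (b ^ u) ⟨
    x / P / b ^ u           ≡⟨ cong (_/ b ^ u) ([m+kn]/n≡k q r<P) ⟩
    q / b ^ u               ∎)
    where
    open ≡-Reasoning
    P = b ^ suc s
    x = r + q * P
    instance
      _ = m^n≢0 b (suc s)
      _ = m^n≢0 b u
      _ = m^n≢0 b (suc s + u)
      _ = m*n≢0 P (b ^ u)

  χ : ℕ → ℕ → ℕ
  χ s = 𝟙 ∘ digit<a s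

  χ-periodic : ∀ s → Periodic (b ^ suc s) (χ s)
  χ-periodic s x = cong (λ d → 𝟙 (d <ᵇ a)) (digit-periodic s x)

  ∑-χ-period : ∀ s → ∑< (b ^ suc s) (χ s) ≡ a * b ^ s
  ∑-χ-period s = begin
    ∑< (b * b ^ s) (χ s)                        ≡⟨ ∑-blocks b (b ^ s) (χ s) ⟩
    ∑[ d < b ] ∑[ r < b ^ s ] χ s (r + d * b ^ s) ≡⟨ ∑-cong b (λ d<b → ∑-cong (b ^ s) (λ r<b^s → cong (λ d → 𝟙 (d <ᵇ a)) (digit-low s r<b^s d<b))) ⟩
    ∑[ d < b ] ∑[ _ < b ^ s ] 𝟙 (d <ᵇ a)        ≡⟨ ∑-cong b (λ {d} _ → trans (∑-const (b ^ s) _) (*-comm (b ^ s) (𝟙 (d <ᵇ a)))) ⟩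
    ∑[ d < b ] (𝟙 (d <ᵇ a) * b ^ s)             ≡⟨ ∑-*ʳ b (b ^ s) (λ d → 𝟙 (d <ᵇ a)) ⟩
    ∑[ d < b ] 𝟙 (d <ᵇ a) * b ^ s               ≡⟨ cong (_* b ^ s) (∑-<ᵇ a≤b) ⟩
    a * b ^ s                                   ∎
    where open ≡-Reasoning

  ∑-χ : ∀ s N → ∑< (N * b ^ suc s) (χ s) ≡ N * (a * b ^ s)
  ∑-χ s N = trans (∑-periodic (χ-periodic s) N) (cong (N *_) (∑-χ-period s))

  b^[s+u+w] : ∀ s u w → b ^ (s + u + w) ≡ b ^ s * b ^ u * b ^ w
  b^[s+u+w] s u w = trans (^-distribˡ-+-* b (s + u) w) (cong (_* b ^ w) (^-distribˡ-+-* b s u))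

  ∑-χ-digits : ∀ {s m} F → s < m → ∑< (b ^ m * F) (χ s) ≡ a * b ^ (m ∸ 1) * F
  ∑-χ-digits {s} F s<m with m≤n⇒∃[o]m+o≡n s<m
  ... | w , refl = begin
    ∑< (b ^ suc (s + w) * F) (χ s)           ≡⟨ cong (λ n → ∑< n (χ s)) v≡NP ⟩
    ∑< (b ^ w * F * b ^ suc s) (χ s)         ≡⟨ ∑-χ s (b ^ w * F) ⟩
    b ^ w * F * (a * b ^ s)                  ≡⟨ merge-counts a (b ^ s) (b ^ w) F ⟩
    a * (b ^ s * b ^ w) * F                  ≡⟨ cong (λ n → a * n * F) (^-distribˡ-+-* b s w) ⟨
    a * b ^ (s + w) * F                      ∎
    where
    open ≡-Reasoning
    split-v : ∀ b S W F → b * (S * W) * F ≡ W * F * (b * S)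
    split-v = solve-∀
    merge-counts : ∀ a S W F → W * F * (a * S) ≡ a * (S * W) * F
    merge-counts = solve-∀
    v≡NP : b ^ suc (s + w) * F ≡ b ^ w * F * b ^ suc s
    v≡NP = trans (cong (λ n → b * n * F) (^-distribˡ-+-* b s w)) (split-v b (b ^ s) (b ^ w) F)

  correlation-χ-digits : ∀ {lo hi m} F {v} .{{_ : NonZero v}} → lo < hi → hi < m → v ≡ b ^ m * F → ∀ h →
    correlation v (χ hi) (χ lo) h ≡ a * a * b ^ (m ∸ 2) * F
  correlation-χ-digits {lo} F lo<hi hi<m v≡ h with m≤n⇒∃[o]m+o≡n lo<hi | m≤n⇒∃[o]m+o≡n hi<m
  ... | u , refl | w , refl = begin
    correlation _ (χ (suc lo + u)) (χ lo) h
      ≡⟨ correlation-factorise {N = b ^ w * F * b ^ suc u} v≡NP {f = χ (suc lo + u)} {F = χ u} (λ q r<P → cong (λ d → 𝟙 (d <ᵇ a)) (digit-high lo u q r<P)) (χ-periodic lo) h ⟩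
    ∑< (b ^ w * F * b ^ suc u) (χ u) * ∑< (b ^ suc lo) (χ lo)
      ≡⟨ cong₂ _*_ (∑-χ u (b ^ w * F)) (∑-χ-period lo) ⟩
    b ^ w * F * (a * b ^ u) * (a * b ^ lo)
      ≡⟨ merge-counts a (b ^ lo) (b ^ u) (b ^ w) F ⟩
    a * a * (b ^ lo * b ^ u * b ^ w) * F
      ≡⟨ cong (λ n → a * a * n * F) (b^[s+u+w] lo u w) ⟨
    a * a * b ^ (lo + u + w) * F
      ∎
    where
    open ≡-Reasoning
    split-v : ∀ b L U W F → b * (b * (L * U * W)) * F ≡ W * F * (b * U) * (b * L)
    split-v = solve-∀
    merge-counts : ∀ a L U W F → W * F * (a * U) * (a * L) ≡ a * a * (L * U * W) * F
    merge-counts = solve-∀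
    v≡NP : _ ≡ (b ^ w * F * b ^ suc u) * b ^ suc lo
    v≡NP = trans v≡ (trans (cong (λ n → b * (b * n) * F) (b^[s+u+w] lo u w)) (split-v b (b ^ lo) (b ^ u) (b ^ w) F))

  digitSets : ∀ {v} m → Fin m → Subset v
  digitSets m i = residues (digit<a (toℕ i))

  digitSets-PSEDF : ∀ m F {n} → 1 < m → suc n ≡ b ^ m * F →
    IsPSEDF (suc n) m (a * b ^ (m ∸ 1) * F) (a * a * b ^ (m ∸ 2) * F) (digitSets m)
  digitSets-PSEDF m F {n} 1<m v≡ = 1<m , size , difference
    where
    size : ∀ i → ∣ digitSets {suc n} m i ∣ ≡ a * b ^ (m ∸ 1) * F
    size i = trans (∣residues∣ (suc n) (digit<a (toℕ i)))
      (trans (cong (λ v → ∑< v (χ (toℕ i))) v≡) (∑-χ-digits F (toℕ<n i)))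
    difference : ∀ i j → i ≢ j → ΔIs (digitSets {suc n} m i) (digitSets m j) (a * a * b ^ (m ∸ 2) * F)
    difference i j i≢j g with <-cmp (toℕ i) (toℕ j)
    ... | tri< i<j _ _ = begin
      ΔCount (digitSets m i) (digitSets m j) g               ≡⟨ ΔCount-residues (digit<a (toℕ i)) (digit<a (toℕ j)) g ⟩
      correlation (suc n) (χ (toℕ i)) (χ (toℕ j)) (suc n ∸ toℕ g) ≡⟨ correlation-comm (suc n) (χ (toℕ i)) (χ (toℕ j)) (<⇒≤ (toℕ<n g)) ⟩
      correlation (suc n) (χ (toℕ j)) (χ (toℕ i)) (toℕ g)    ≡⟨ correlation-χ-digits F i<j (toℕ<n j) v≡ (toℕ g) ⟩
      a * a * b ^ (m ∸ 2) * F                                ∎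
      where open ≡-Reasoning
    ... | tri≈ _ i≡j _ = contradiction (toℕ-injective i≡j) i≢j
    ... | tri> _ _ j<i = trans (ΔCount-residues (digit<a (toℕ i)) (digit<a (toℕ j)) g)
                           (correlation-χ-digits F j<i (toℕ<n i) v≡ (suc n ∸ toℕ g))

  digitSets-PSEDFExists : ∀ m F → 1 < m → 1 ≤ F → PSEDFExists (b ^ m * F) m (a * b ^ (m ∸ 1) * F) (a * a * b ^ (m ∸ 2) * F)
  digitSets-PSEDFExists m F 1<m 1≤F =
    subst (λ v → PSEDFExists v m (a * b ^ (m ∸ 1) * F) (a * a * b ^ (m ∸ 2) * F)) (suc-pred v) (digitSets m , digitSets-PSEDF m F 1<m (suc-pred v))
    where
    v = b ^ m * F
    instance _ = m*n≢0 (b ^ m) F {{m^n≢0 b m}} {{>-nonZero 1≤F}}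

prodFin-positive : ∀ n (f : Fin n → ℕ) → (∀ i → 1 ≤ f i) → 1 ≤ prodFin n f
prodFin-positive zero    f 1≤f = s≤s z≤n
prodFin-positive (suc n) f 1≤f = *-mono-≤ (1≤f fzero) (prodFin-positive n (f ∘ fsuc) (1≤f ∘ fsuc))

k*b≡v*a⇒k≡ : ∀ {a b m F k} .{{_ : NonZero b}} → 1 ≤ m → k * b ≡ b ^ m * F * a → k ≡ a * b ^ (m ∸ 1) * F
k*b≡v*a⇒k≡ {a} {b} {suc m} {F} {k} (s≤s _) k*b≡ = *-cancelʳ-≡ k _ b (trans k*b≡ (rearrange b (b ^ m) F a))
  where
  rearrange : ∀ b B F a → b * B * F * a ≡ a * B * F * b
  rearrange = solve-∀

λ*b²≡v*a²⇒λ≡ : ∀ {a b m F λ'} .{{_ : NonZero b}} → 2 ≤ m → λ' * (b * b) ≡ b ^ m * F * (a * a) → λ' ≡ a * a * b ^ (m ∸ 2) * F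
λ*b²≡v*a²⇒λ≡ {a} {b} {suc (suc m)} {F} {λ'} (s≤s (s≤s _)) λ*b²≡ = *-cancelʳ-≡ λ' _ (b * b) {{m*n≢0 b b}} (trans λ*b²≡ (rearrange b (b ^ m) F a))
  where
  rearrange : ∀ b B F a → b * (b * B) * F * (a * a) ≡ a * a * B * F * (b * b)
  rearrange = solve-∀

corollary3p5 :
    -- (i): z = a / b with 0 < z < 1, i.e. 0 < a < b; v = b^m f_0 ⋯ f_m; k = v z, λ = v z²
    ((a b m : ℕ) → 0 < a → a < b → 2 ≤ m →
      (f : Fin (suc m) → ℕ) → ((i : Fin (suc m)) → 1 ≤ f i) →
      (v k λ' : ℕ) → v ≡ b ^ m * prodFin (suc m) f →
      k * b ≡ v * a → λ' * (b * b) ≡ v * (a * a) →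
      PSEDFExists v m k λ')
    ×
    -- (ii)
    ((f b m a : ℕ) → 1 ≤ f → 2 ≤ b → 2 ≤ m → 1 ≤ a → a < b →
      PSEDFExists (b ^ m * f) m (a * b ^ (m ∸ 1) * f) (a * a * b ^ (m ∸ 2) * f))
corollary3p5 = part-i , part-ii
  where
  part-ii : (f b m a : ℕ) → 1 ≤ f → 2 ≤ b → 2 ≤ m → 1 ≤ a → a < b →
    PSEDFExists (b ^ m * f) m (a * b ^ (m ∸ 1) * f) (a * a * b ^ (m ∸ 2) * f)
  part-ii f b m a 1≤f _ 2≤m _ a<b =
    DigitSets.digitSets-PSEDFExists b {{>-nonZero (≤-<-trans z≤n a<b)}} (<⇒≤ a<b) m f 2≤m 1≤f

  part-i : (a b m : ℕ) → 0 < a → a < b → 2 ≤ m →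
    (f : Fin (suc m) → ℕ) → ((i : Fin (suc m)) → 1 ≤ f i) →
    (v k λ' : ℕ) → v ≡ b ^ m * prodFin (suc m) f →
    k * b ≡ v * a → λ' * (b * b) ≡ v * (a * a) →
    PSEDFExists v m k λ'
  part-i a b m _ a<b 2≤m f 1≤f v k λ' refl k*b≡ λ*b²≡ =
    subst₂ (PSEDFExists v m) (sym (k*b≡v*a⇒k≡ {a} (<⇒≤ 2≤m) k*b≡)) (sym (λ*b²≡v*a²⇒λ≡ {a} 2≤m λ*b²≡))
      (DigitSets.digitSets-PSEDFExists b (<⇒≤ a<b) m F 2≤m (prodFin-positive (suc m) f 1≤f))
    where
    F = prodFin (suc m) f
    instance _ = >-nonZero (≤-<-trans z≤n a<b)
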